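{- Let $T$ be a minimal-ABC tree (of order $n\ge10$), regarded as a rooted tree. Then $T$ does not contain, as a subtree, a proper $T_k$-branch with $k\ge 8$ whose root's children are all roots of $B_2$-branches or $B_1$-branches. Moreover, $T$ cannot itself be a proper $T_k$-tree with $k\ge 7$ whose root's children are all roots of $B_2$-branches or $B_1$-branches.
   Context: For a tree $G$ and an edge $uv$, let $f(d(u),d(v))=\sqrt{\frac{d(u)+d(v)-2}{d(u)d(v)}}$, where $d(\cdot)$ is the vertex degree; $\mathrm{ABC}(G)=\sum_{uv\in E(G)} f(d(u),d(v))$. A minimal-ABC tree is a tree with minimum ABC index among all trees with the same number of vertices; trees of order at least $10$ are considered. Trees are regarded as rooted trees. For $k\ge1$, a $B_k$-branch is a subtree consisting of a vertex $v$ together with all its descendants, where $v$ has exactly $k$ children, each of degree $2$, each having exactly one child which is a leaf. A pendant path of length two (resp. three) at a vertex $v$ of degree $\ge3$ is a path $v\,v_1\,v_2$ (resp. $v\,v_1\,v_2\,v_3$) whose internal vertices have degree $2$ and whose last vertex is a leaf. A $k$-terminal vertex is a vertex of degree $k\ge 3$ adjacent to a pendant path of length two or three. A $T_k$-branch is the subtree induced by a $(k+1)$-terminal vertex and all its descendants; it is proper if its terminal (root) vertex has at least one child of degree at least $3$. A tree is a proper $T_k$-tree if the whole tree consists of one proper $T_k$-branch, rooted at its terminal vertex (which then has $k$ children). -}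

module Defs where

open import Data.Nat as ℕ using (ℕ; zero; suc; _∸_)
open import Data.Integer using (+_)
open import Data.Rational.Unnormalised as Q using (ℚᵘ; mkℚᵘ; 0ℚᵘ)
open import Data.List using (List; []; _∷_; _++_; length; foldr)
open import Data.List.Relation.Unary.All using (All)
open import Data.List.Relation.Unary.Any using (Any)
open import Data.List.Relation.Binary.Pointwise using (Pointwise)
open import Data.List.Membership.Propositional using (_∈_)
open import Data.Product using (_×_; _,_; ∃; ∃-syntax)
open import Data.Sum using (_⊎_)
open import Relation.Binary.PropositionalEquality using (_≡_)
open import Relation.Nullary using (¬_)

-- Finite rooted (rose) trees.  Every finite tree admits such a
-- representation (choose a root); the ABC index does not depend on it.

data Tree : Set where
  node : List Tree → Tree

children : Tree → List Tree
children (node ts) = ts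

mutual
  size : Tree → ℕ
  size (node ts) = suc (sizes ts)

  sizes : List Tree → ℕ
  sizes []       = 0
  sizes (t ∷ ts) = size t ℕ.+ sizes ts

-- Edges as pairs (d(parent), d(child)) of vertex degrees.
-- A non-root vertex with children us has degree 1 + length us;
-- the root with children ts has degree length ts.

edgesCh : ℕ → List Tree → List (ℕ × ℕ)
edgesCh dp []               = []
edgesCh dp (node us ∷ ts) =
  (dp , suc (length us)) ∷ (edgesCh (suc (length us)) us ++ edgesCh dp ts)

edges : Tree → List (ℕ × ℕ)
edges (node ts) = edgesCh (length ts) ts

-- the square  f(a,b)^2 = (a + b - 2) / (a b)   (degrees are ≥ 1 on edges)
fSq : ℕ × ℕ → ℚᵘ
fSq (a , b) = mkℚᵘ (+ (a ℕ.+ b ∸ 2)) (a ℕ.* b ∸ 1)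

abcSq : Tree → List ℚᵘ
abcSq t = Data.List.map fSq (edges t)
  where import Data.List

sumℚ : List ℚᵘ → ℚᵘ
sumℚ = foldr Q._+_ 0ℚᵘ

-- Strict comparison of sums of square roots of nonnegative rationals:
--   Σ √xᵢ < Σ √yⱼ  iff there are rational upper bounds uᵢ ≥ √xᵢ and
--   rational lower bounds 0 ≤ lⱼ ≤ √yⱼ with Σ uᵢ < Σ lⱼ.

UpperSqrt : List ℚᵘ → List ℚᵘ → Set
UpperSqrt = Pointwise (λ x u → (0ℚᵘ Q.≤ u) × (x Q.≤ u Q.* u))

LowerSqrt : List ℚᵘ → List ℚᵘ → Set
LowerSqrt = Pointwise (λ y l → (0ℚᵘ Q.≤ l) × (l Q.* l Q.≤ y))

SqrtSumLt : List ℚᵘ → List ℚᵘ → Set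
SqrtSumLt xs ys =
  ∃[ us ] ∃[ ls ] (UpperSqrt xs us × LowerSqrt ys ls × (sumℚ us Q.< sumℚ ls))

ABCLt : Tree → Tree → Set
ABCLt T T' = SqrtSumLt (abcSq T) (abcSq T')

MinimalABC : Tree → Set
MinimalABC T =
  (10 ℕ.≤ size T) × (∀ T' → size T' ≡ size T → ¬ ABCLt T' T)

-- Descendant subtrees: S ⊏ T  iff S is the branch (vertex + all its
-- descendants) of some non-root vertex of T.

data _⊏_ : Tree → Tree → Set where
  child : ∀ {S T} → S ∈ children T → S ⊏ T
  deeper : ∀ {S C T} → C ∈ children T → S ⊏ C → S ⊏ T

degNR : Tree → ℕ
degNR t = suc (length (children t))

-- a child c of v starting a pendant path v c leaf  (length two)
-- or v c c' leaf (length three)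
P2 : Tree
P2 = node (node [] ∷ [])

P3 : Tree
P3 = node (P2 ∷ [])

-- root (non-root vertex) of a B_k-branch: exactly k children, each of
-- degree 2 with exactly one child which is a leaf
IsB : ℕ → Tree → Set
IsB k t = (1 ℕ.≤ k) × (length (children t) ≡ k) × All (λ c → c ≡ P2) (children t)

AllChildrenB12 : Tree → Set
AllChildrenB12 t = All (λ c → IsB 1 c ⊎ IsB 2 c) (children t)

HasPendantPath : Tree → Set
HasPendantPath t = Any (λ c → (c ≡ P2) ⊎ (c ≡ P3)) (children t)

-- proper T_k-branch rooted at a non-root vertex t: t is a
-- (k+1)-terminal vertex (k children, degree k+1 ≥ 3) with a child of
-- degree ≥ 3
ProperTBranch : ℕ → Tree → Set
ProperTBranch k t =
  (length (children t) ≡ k) × (3 ℕ.≤ suc k) × HasPendantPath t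
  × Any (λ c → 3 ℕ.≤ degNR c) (children t)

-- the whole tree is a proper T_k-tree: the root is a k-terminal vertex
-- with k children and a child of degree ≥ 3
ProperTTree : ℕ → Tree → Set
ProperTTree k t =
  (length (children t) ≡ k) × (3 ℕ.≤ k) × HasPendantPath t
  × Any (λ c → 3 ℕ.≤ degNR c) (children t)

-- A vertex of degree D ≥ 7 whose children are B₁- and B₂-branches, at least
-- one of each and at least four in all, allows a regrouping of a few children
-- that keeps the order and lowers the ABC index: three B₁ become P2, P2, B₂;
-- two B₁ and a B₂ become P2, P2, B₃; one B₁ and three B₂ become P2, P2, B₃, B₃.
-- Every edge with an endpoint of degree 2 weighs 1/√2, so each move compares a
-- few values f(D , c) = √((D + c − 2)/(cD)), checked with six-digit decimal
-- bounds.  To compare whole trees, every f(e) is rounded down to a grid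
-- 1/(K + 1) with K large compared with the number of edges; the local gain
-- then outweighs the rounding error of the unchanged edges.

module Submission where

open import Defs
open import Data.Bool using (T)
open import Data.Integer as ℤ using (+_)
open import Data.Integer.Properties using (pos-*; pos-+)
open import Data.List using (List; []; _∷_; _++_; length; map; replicate)
open import Data.List.Properties
  using (++-assoc; length-++; length-++-≤ˡ; length-++-≤ʳ; length-replicate; map-++)
open import Data.List.Membership.Propositional.Properties using (∈-∃++)
open import Data.List.Relation.Binary.Permutation.Propositional using (_↭_; prep; swap; ↭-sym)
  renaming (refl to ↭-refl; trans to ↭-trans)
open import Data.List.Relation.Binary.Permutation.Propositional.Properties
  using (↭-length; ++⁺ˡ; shift; shifts; Any-resp-↭)
  renaming (map⁺ to map⁺-↭)
open import Data.List.Relation.Binary.Pointwise using (Pointwise; []; _∷_)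
  renaming (++⁺ to infixr 5 _++ᵖ_)
open import Data.List.Relation.Unary.All using (All; []; _∷_)
open import Data.List.Relation.Unary.Any using (Any; here; there)
open import Data.List.Relation.Unary.Any.Properties using (++⁻)
open import Data.Nat using (ℕ; zero; suc; _+_; _*_; _∸_; _≤_; _<_; z≤n; s≤s; _≤?_; _≤ᵇ_; NonZero)
open import Data.Nat.ListAction using (sum)
open import Data.Nat.ListAction.Properties using (sum-++; sum-↭)
open import Data.Nat.Properties
open import Data.Nat.Tactic.RingSolver using (solve-∀)
open import Data.Product using (_×_; _,_; proj₂; ∃-syntax; ∃₂)
open import Data.Rational.Unnormalised as Q using (ℚᵘ; mkℚᵘ; *≤*; *<*; *≡*)
import Data.Rational.Unnormalised.Properties as Q
open import Data.Sum using (_⊎_; inj₁; inj₂)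
open import Relation.Binary.PropositionalEquality
open import Relation.Nullary using (¬_; yes; no; contradiction)

decide : ∀ {m n} {_ : T (m ≤ᵇ n)} → m ≤ n
decide {m} {n} {m≤ᵇn} = ≤ᵇ⇒≤ m n m≤ᵇn

m*m≤n*n⇒m≤n : ∀ {m n} → m * m ≤ n * n → m ≤ n
m*m≤n*n⇒m≤n {m} {n} m*m≤n*n with m ≤? n
... | yes m≤n = m≤n
... | no m≰n = contradiction m*m≤n*n (<⇒≱ (*-mono-< n<m n<m))
  where n<m = ≰⇒> m≰n

largest-root≤ : (q m n : ℕ) → ℕ
largest-root≤ q m zero = zero
largest-root≤ q m (suc n) with suc n * suc n * suc q ≤? m
... | yes _ = suc n
... | no  _ = largest-root≤ q m n

largest-root≤-sound : ∀ q m n → largest-root≤ q m n * largest-root≤ q m n * suc q ≤ m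
largest-root≤-sound q m zero = z≤n
largest-root≤-sound q m (suc n) with suc n * suc n * suc q ≤? m
... | yes fits = fits
... | no  _    = largest-root≤-sound q m n

largest-root≤-maximal : ∀ q m n → m < suc n * suc n * suc q →
  m < suc (largest-root≤ q m n) * suc (largest-root≤ q m n) * suc q
largest-root≤-maximal q m zero m<1+q = m<1+q
largest-root≤-maximal q m (suc n) m<n² with suc n * suc n * suc q ≤? m
... | yes _     = m<n²
... | no  ¬fits = largest-root≤-maximal q m n (≰⇒> ¬fits)

⌊√_/suc_⌋ : ℕ → ℕ → ℕ
⌊√ m /suc q ⌋ = largest-root≤ q m m

⌊√⌋-sound : ∀ m q → ⌊√ m /suc q ⌋ * ⌊√ m /suc q ⌋ * suc q ≤ m
⌊√⌋-sound m q = largest-root≤-sound q m m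

⌊√⌋-next : ∀ m q → m < suc ⌊√ m /suc q ⌋ * suc ⌊√ m /suc q ⌋ * suc q
⌊√⌋-next m q = largest-root≤-maximal q m m
  (≤-trans (m≤m*n (suc m) (suc m)) (m≤m*n (suc m * suc m) (suc q)))

⌊√⌋-lower : ∀ B l p q N → l * l * suc q ≤ p * (B * B) →
  l * N ≤ B * suc ⌊√ p * (N * N) /suc q ⌋
⌊√⌋-lower B l p q N l²≤pB² = m*m≤n*n⇒m≤n (*-cancelʳ-≤ _ _ (suc q) (begin
  l * N * (l * N) * suc q      ≡⟨ e₁ l N (suc q) ⟩
  l * l * suc q * (N * N)      ≤⟨ *-monoˡ-≤ (N * N) l²≤pB² ⟩
  p * (B * B) * (N * N)        ≡⟨ e₂ p B N ⟩
  B * B * (p * (N * N))        ≤⟨ *-monoʳ-≤ (B * B) (<⇒≤ (⌊√⌋-next (p * (N * N)) q)) ⟩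
  B * B * (r′ * r′ * suc q)    ≡⟨ e₃ B r′ (suc q) ⟩
  B * r′ * (B * r′) * suc q    ∎))
  where
  open ≤-Reasoning
  r′ = suc ⌊√ p * (N * N) /suc q ⌋
  e₁ : ∀ l N s → l * N * (l * N) * s ≡ l * l * s * (N * N)
  e₁ = solve-∀
  e₂ : ∀ p B N → p * (B * B) * (N * N) ≡ B * B * (p * (N * N))
  e₂ = solve-∀
  e₃ : ∀ B r s → B * B * (r * r * s) ≡ B * r * (B * r) * s
  e₃ = solve-∀

⌊√⌋-upper : ∀ B h p q N → p * (B * B) ≤ h * h * suc q →
  B * ⌊√ p * (N * N) /suc q ⌋ ≤ h * N
⌊√⌋-upper B h p q N pB²≤h² = m*m≤n*n⇒m≤n (*-cancelʳ-≤ _ _ (suc q) (begin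
  B * r * (B * r) * suc q      ≡⟨ e₁ B r (suc q) ⟩
  B * B * (r * r * suc q)      ≤⟨ *-monoʳ-≤ (B * B) (⌊√⌋-sound (p * (N * N)) q) ⟩
  B * B * (p * (N * N))        ≡⟨ e₂ B p N ⟩
  p * (B * B) * (N * N)        ≤⟨ *-monoˡ-≤ (N * N) pB²≤h² ⟩
  h * h * suc q * (N * N)      ≡⟨ e₃ h N (suc q) ⟩
  h * N * (h * N) * suc q      ∎))
  where
  open ≤-Reasoning
  r = ⌊√ p * (N * N) /suc q ⌋
  e₁ : ∀ B r s → B * r * (B * r) * s ≡ B * B * (r * r * s)
  e₁ = solve-∀
  e₂ : ∀ B p N → B * B * (p * (N * N)) ≡ p * (B * B) * (N * N)
  e₂ = solve-∀
  e₃ : ∀ h N s → h * h * s * (N * N) ≡ h * N * (h * N) * s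
  e₃ = solve-∀

num pden : ℕ × ℕ → ℕ
num (a , c) = a + c ∸ 2
pden (a , c) = a * c ∸ 1

⌊f⌋ : ℕ → ℕ × ℕ → ℕ
⌊f⌋ K e = ⌊√ num e * (suc K * suc K) /suc pden e ⌋

floorSum : ℕ → List (ℕ × ℕ) → ℕ
floorSum K es = sum (map (⌊f⌋ K) es)

floorSum-++ : ∀ K xs ys → floorSum K (xs ++ ys) ≡ floorSum K xs + floorSum K ys
floorSum-++ K xs ys = trans (cong sum (map-++ (⌊f⌋ K) xs ys)) (sum-++ (map (⌊f⌋ K) xs) _)

floorSum-↭ : ∀ K {xs ys} → xs ↭ ys → floorSum K xs ≡ floorSum K ys
floorSum-↭ K xs↭ys = sum-↭ (map⁺-↭ (⌊f⌋ K) xs↭ys)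

mkℚᵘ-≤ : ∀ {a b c d} → a * suc d ≤ c * suc b → mkℚᵘ (+ a) b Q.≤ mkℚᵘ (+ c) d
mkℚᵘ-≤ {a} {b} {c} {d} ad≤cb = *≤* (subst₂ ℤ._≤_ (pos-* a (suc d)) (pos-* c (suc b)) (ℤ.+≤+ ad≤cb))

mkℚᵘ-< : ∀ {a b c d} → a * suc d < c * suc b → mkℚᵘ (+ a) b Q.< mkℚᵘ (+ c) d
mkℚᵘ-< {a} {b} {c} {d} ad<cb = *<* (subst₂ ℤ._<_ (pos-* a (suc d)) (pos-* c (suc b)) (ℤ.+<+ ad<cb))

mkℚᵘ-square : ∀ r K → mkℚᵘ (+ r) K Q.* mkℚᵘ (+ r) K ≡ mkℚᵘ (+ (r * r)) (K + K * suc K)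
mkℚᵘ-square r K = cong (λ n → mkℚᵘ n (K + K * suc K)) (sym (pos-* r r))

mkℚᵘ-+ : ∀ a b K → mkℚᵘ (+ a) K Q.+ mkℚᵘ (+ b) K Q.≃ mkℚᵘ (+ (a + b)) K
mkℚᵘ-+ a b K = *≡* (begin
  (+ a ℤ.* + N ℤ.+ + b ℤ.* + N) ℤ.* + N
    ≡⟨ cong (ℤ._* + N) (cong₂ ℤ._+_ (pos-* a N) (pos-* b N)) ⟨
  (+ (a * N) ℤ.+ + (b * N)) ℤ.* + N
    ≡⟨ cong (ℤ._* + N) (pos-+ (a * N) (b * N)) ⟨
  + (a * N + b * N) ℤ.* + N
    ≡⟨ pos-* (a * N + b * N) N ⟨
  + ((a * N + b * N) * N)
    ≡⟨ cong +_ (distrib a b N) ⟩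
  + ((a + b) * (N * N))
    ≡⟨ pos-* (a + b) (N * N) ⟩
  + (a + b) ℤ.* + (N * N) ∎)
  where
  open ≡-Reasoning
  N = suc K
  distrib : ∀ a b N → (a * N + b * N) * N ≡ (a + b) * (N * N)
  distrib = solve-∀

sumℚ-mkℚᵘ : ∀ {A : Set} (g : A → ℕ) K xs →
  sumℚ (map (λ x → mkℚᵘ (+ g x) K) xs) Q.≃ mkℚᵘ (+ sum (map g xs)) K
sumℚ-mkℚᵘ g K [] = *≡* refl
sumℚ-mkℚᵘ g K (x ∷ xs) =
  Q.≃-trans (Q.+-congʳ (mkℚᵘ (+ g x) K) (sumℚ-mkℚᵘ g K xs)) (mkℚᵘ-+ (g x) _ K)

sum-map-suc : ∀ {A : Set} (g : A → ℕ) xs → sum (map (λ x → suc (g x)) xs) ≡ sum (map g xs) + length xs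
sum-map-suc g [] = refl
sum-map-suc g (x ∷ xs) = trans (cong (λ s → suc (g x + s)) (sum-map-suc g xs)) (shuffle (g x) _ _)
  where
  shuffle : ∀ a b c → suc (a + (b + c)) ≡ a + b + suc c
  shuffle = solve-∀

lowerℚ upperℚ : ℕ → ℕ × ℕ → ℚᵘ
lowerℚ K e = mkℚᵘ (+ ⌊f⌋ K e) K
upperℚ K e = mkℚᵘ (+ suc (⌊f⌋ K e)) K

lowerℚ-LowerSqrt : ∀ K es → LowerSqrt (map fSq es) (map (lowerℚ K) es)
lowerℚ-LowerSqrt K [] = []
lowerℚ-LowerSqrt K ((a , c) ∷ es) =
  (mkℚᵘ-≤ z≤n , subst (Q._≤ fSq (a , c)) (sym (mkℚᵘ-square (⌊f⌋ K (a , c)) K))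
                 (mkℚᵘ-≤ (⌊√⌋-sound (num (a , c) * (suc K * suc K)) (pden (a , c)))))
  ∷ lowerℚ-LowerSqrt K es

upperℚ-UpperSqrt : ∀ K es → UpperSqrt (map fSq es) (map (upperℚ K) es)
upperℚ-UpperSqrt K [] = []
upperℚ-UpperSqrt K ((a , c) ∷ es) =
  (mkℚᵘ-≤ z≤n , subst (fSq (a , c) Q.≤_) (sym (mkℚᵘ-square (suc (⌊f⌋ K (a , c))) K))
                 (mkℚᵘ-≤ (<⇒≤ (⌊√⌋-next (num (a , c) * (suc K * suc K)) (pden (a , c))))))
  ∷ upperℚ-UpperSqrt K es

floorSum-SqrtSumLt : ∀ K E′ E → floorSum K E′ + length E′ < floorSum K E →
  SqrtSumLt (map fSq E′) (map fSq E)
floorSum-SqrtSumLt K E′ E gap =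
  map (upperℚ K) E′ , map (lowerℚ K) E , upperℚ-UpperSqrt K E′ , lowerℚ-LowerSqrt K E ,
  Q.<-respʳ-≃ (Q.≃-sym lowerSum) (Q.<-respˡ-≃ (Q.≃-sym upperSum) (mkℚᵘ-< (*-monoˡ-< (suc K) gap)))
  where
  upperSum : sumℚ (map (upperℚ K) E′) Q.≃ mkℚᵘ (+ (floorSum K E′ + length E′)) K
  upperSum = subst (λ n → sumℚ (map (upperℚ K) E′) Q.≃ mkℚᵘ (+ n) K) (sum-map-suc (⌊f⌋ K) E′)
                   (sumℚ-mkℚᵘ (λ e → suc (⌊f⌋ K e)) K E′)
  lowerSum : sumℚ (map (lowerℚ K) E) Q.≃ mkℚᵘ (+ floorSum K E) K
  lowerSum = sumℚ-mkℚᵘ (⌊f⌋ K) K E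

-- Unlike a SqrtSumLt certificate, this survives
-- appending common edges to both sides, whose rounding errors M absorbs.
infix 4 _≺_
record _≺_ (E′ E : List (ℕ × ℕ)) : Set where
  constructor robustly
  field
    scale : ℕ
    gap   : ∀ M K → length E ≤ M → scale * suc M ≤ suc K → floorSum K E′ + M < floorSum K E

≺⇒SqrtSumLt : ∀ {E′ E} → length E′ ≤ length E → E′ ≺ E → SqrtSumLt (map fSq E′) (map fSq E)
≺⇒SqrtSumLt {E′} {E} ∣E′∣≤∣E∣ (robustly c gap) = floorSum-SqrtSumLt K E′ E
  (≤-<-trans (+-monoʳ-≤ (floorSum K E′) ∣E′∣≤∣E∣) (gap (length E) K ≤-refl (n≤1+n K)))
  where K = c * suc (length E)

≺-++ˡ : ∀ {E′ E} P → E′ ≺ E → P ++ E′ ≺ P ++ E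
≺-++ˡ {E′} {E} P (robustly c gap) = robustly c λ M K ∣PE∣≤M fine →
  subst₂ (λ x y → x + M < y) (sym (floorSum-++ K P E′)) (sym (floorSum-++ K P E))
    (subst (_< floorSum K P + floorSum K E) (sym (+-assoc (floorSum K P) (floorSum K E′) M))
      (+-monoʳ-< (floorSum K P) (gap M K (≤-trans (length-++-≤ʳ E {P}) ∣PE∣≤M) fine)))

≺-++ʳ : ∀ {E′ E} Q → E′ ≺ E → E′ ++ Q ≺ E ++ Q
≺-++ʳ {E′} {E} Q (robustly c gap) = robustly c λ M K ∣EQ∣≤M fine →
  subst₂ (λ x y → x + M < y) (sym (floorSum-++ K E′ Q)) (sym (floorSum-++ K E Q))
    (subst (_< floorSum K E + floorSum K Q) (swap-middle (floorSum K E′) (floorSum K Q) M)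
      (+-monoˡ-< (floorSum K Q) (gap M K (≤-trans (length-++-≤ˡ E) ∣EQ∣≤M) fine)))
  where
  swap-middle : ∀ a b c → a + c + b ≡ a + b + c
  swap-middle = solve-∀

≺-respʳ-↭ : ∀ {E′ E F} → E′ ≺ E → E ↭ F → E′ ≺ F
≺-respʳ-↭ {E′} (robustly c gap) E↭F = robustly c λ M K ∣F∣≤M fine →
  subst (floorSum K E′ + M <_) (floorSum-↭ K E↭F) (gap M K (subst (_≤ M) (sym (↭-length E↭F)) ∣F∣≤M) fine)

-- f(e) ≤ h / B  and  l / B ≤ f(e); records, so that B, e and h are inferable.
record Above (B : ℕ) (e : ℕ × ℕ) (h : ℕ) : Set where
  constructor above
  field bound : num e * (B * B) ≤ h * h * suc (pden e)

record Below (B : ℕ) (e : ℕ × ℕ) (l : ℕ) : Set where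
  constructor below
  field bound : l * l * suc (pden e) ≤ num e * (B * B)

floorSum-Above : ∀ {B K es hs} → Pointwise (Above B) es hs → B * floorSum K es ≤ sum hs * suc K
floorSum-Above {B} [] = ≤-reflexive (*-zeroʳ B)
floorSum-Above {B} {K} {e ∷ es} {h ∷ hs} (above fe≤h ∷ es≤hs) = begin
  B * (⌊f⌋ K e + floorSum K es)        ≡⟨ *-distribˡ-+ B _ _ ⟩
  B * ⌊f⌋ K e + B * floorSum K es      ≤⟨ +-mono-≤ (⌊√⌋-upper B h (num e) (pden e) (suc K) fe≤h) (floorSum-Above es≤hs) ⟩
  h * suc K + sum hs * suc K           ≡⟨ *-distribʳ-+ (suc K) h (sum hs) ⟨
  (h + sum hs) * suc K                 ∎
  where open ≤-Reasoning

floorSum-Below : ∀ {B K es ls} → Pointwise (Below B) es ls →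
  sum ls * suc K ≤ B * (floorSum K es + length es)
floorSum-Below [] = z≤n
floorSum-Below {B} {K} {e ∷ es} {l ∷ ls} (below l≤fe ∷ ls≤es) = begin
  (l + sum ls) * suc K                               ≡⟨ *-distribʳ-+ (suc K) l (sum ls) ⟩
  l * suc K + sum ls * suc K                         ≤⟨ +-mono-≤ (⌊√⌋-lower B l (num e) (pden e) (suc K) l≤fe) (floorSum-Below ls≤es) ⟩
  B * suc r + B * (floorSum K es + length es)        ≡⟨ regroup B r (floorSum K es) (length es) ⟩
  B * (r + floorSum K es + suc (length es))          ∎
  where
  open ≤-Reasoning
  r = ⌊f⌋ K e
  regroup : ∀ B r F n → B * suc r + B * (F + n) ≡ B * (r + F + suc n)
  regroup = solve-∀

-- The margin beats the rounding error because K + 1 ≥ 2 B (M + 1) covers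
-- one unit per edge of E and per unit of M.
certified-≺ : ∀ {B E′ E hs ls} .{{_ : NonZero B}} →
  Pointwise (Above B) E′ hs → Pointwise (Below B) E ls → sum hs < sum ls → E′ ≺ E
certified-≺ {B} {E′} {E} {hs} {ls} E′≤hs ls≤E margin = robustly (B + B) λ M K ∣E∣≤M fine →
  +-cancelʳ-≤ (length E) _ _ (*-cancelˡ-≤ B (begin
    B * (suc (floorSum K E′ + M) + length E)      ≡⟨ split B (floorSum K E′) M (length E) ⟩
    B * floorSum K E′ + B * (suc M + length E)    ≤⟨ +-mono-≤ (floorSum-Above E′≤hs) (rounding M K ∣E∣≤M fine) ⟩
    sum hs * suc K + suc K                        ≡⟨ +-comm _ (suc K) ⟩
    suc (sum hs) * suc K                          ≤⟨ *-monoˡ-≤ (suc K) margin ⟩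
    sum ls * suc K                                ≤⟨ floorSum-Below ls≤E ⟩
    B * (floorSum K E + length E)                 ∎))
  where
  open ≤-Reasoning
  split : ∀ B F M n → B * (suc (F + M) + n) ≡ B * F + B * (suc M + n)
  split = solve-∀
  double : ∀ B M → B * (suc M + suc M) ≡ (B + B) * suc M
  double = solve-∀
  rounding : ∀ M K → length E ≤ M → (B + B) * suc M ≤ suc K → B * (suc M + length E) ≤ suc K
  rounding M K ∣E∣≤M fine = begin
    B * (suc M + length E)    ≤⟨ *-monoʳ-≤ B (+-monoʳ-≤ (suc M) (m≤n⇒m≤1+n ∣E∣≤M)) ⟩
    B * (suc M + suc M)       ≡⟨ double B M ⟩
    (B + B) * suc M           ≤⟨ fine ⟩
    suc K                     ∎

above-½ : ∀ {B h d} → B * B ≤ h * h * 2 → Above B (suc d , 2) h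
above-½ {B} {h} {d} B²≤2h² = above (begin
  (suc d + 2 ∸ 2) * (B * B)   ≡⟨ cong (_* (B * B)) (m+n∸n≡m (suc d) 2) ⟩
  suc d * (B * B)             ≤⟨ *-monoʳ-≤ (suc d) B²≤2h² ⟩
  suc d * (h * h * 2)         ≡⟨ reorder (suc d) h ⟩
  h * h * (suc d * 2)         ∎)
  where
  open ≤-Reasoning
  reorder : ∀ D h → D * (h * h * 2) ≡ h * h * (D * 2)
  reorder = solve-∀

num-edge : ∀ a j → num (suc a , 2 + j) ≡ suc a + j
num-edge a j = trans (cong (_∸ 2) (+-comm (suc a) (2 + j))) (+-comm j (suc a))

above-mono : ∀ {B h a d j} → a ≤ d → Above B (suc a , 2 + j) h → Above B (suc d , 2 + j) h
above-mono {B} {h} {a} {d} {j} a≤d (above fa≤h) with m≤n⇒∃[o]m+o≡n a≤d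
... | m , refl = above (subst (λ n → n * BB ≤ H * (suc (a + m) * c)) (sym (num-edge (a + m) j)) (begin
  (suc (a + m) + j) * BB            ≡⟨ split (suc a) m j BB ⟩
  (suc a + j) * BB + m * BB         ≤⟨ +-mono-≤ fa≤h′ (*-monoʳ-≤ m BB≤Hc) ⟩
  H * (suc a * c) + m * (H * c)     ≡⟨ merge H (suc a) m c ⟩
  H * (suc (a + m) * c)             ∎))
  where
  open ≤-Reasoning
  BB = B * B
  H = h * h
  c = 2 + j
  fa≤h′ : (suc a + j) * BB ≤ H * (suc a * c)
  fa≤h′ = subst (λ n → n * BB ≤ H * (suc a * c)) (num-edge a j) fa≤h
  BB≤Hc : BB ≤ H * c
  BB≤Hc = *-cancelˡ-≤ (suc a) (begin
    suc a * BB          ≤⟨ *-monoˡ-≤ BB (m≤m+n (suc a) j) ⟩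
    (suc a + j) * BB    ≤⟨ fa≤h′ ⟩
    H * (suc a * c)     ≡⟨ *-comm H (suc a * c) ⟩
    suc a * c * H       ≡⟨ *-assoc (suc a) c H ⟩
    suc a * (c * H)     ≡⟨ cong (suc a *_) (*-comm c H) ⟩
    suc a * (H * c)     ∎)
  split : ∀ A m j X → (A + m + j) * X ≡ (A + j) * X + m * X
  split = solve-∀
  merge : ∀ H A m c → H * (A * c) + m * (H * c) ≡ H * ((A + m) * c)
  merge = solve-∀

below-anti : ∀ {B l b d j} → d ≤ b → Below B (suc b , 2 + j) l → Below B (suc d , 2 + j) l
below-anti {B} {l} {b} {d} {j} d≤b (below l≤fb) =
  below (subst (λ n → L * (suc d * c) ≤ n * BB) (sym (num-edge d j)) (*-cancelˡ-≤ (suc b) (begin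
    suc b * (L * (suc d * c))        ≡⟨ swap-degrees L (suc b) (suc d) c ⟩
    suc d * (L * (suc b * c))        ≤⟨ *-monoʳ-≤ (suc d) l≤fb′ ⟩
    suc d * ((suc b + j) * BB)       ≡⟨ *-assoc (suc d) (suc b + j) BB ⟨
    suc d * (suc b + j) * BB         ≤⟨ *-monoˡ-≤ BB cross ⟩
    suc b * (suc d + j) * BB         ≡⟨ *-assoc (suc b) (suc d + j) BB ⟩
    suc b * ((suc d + j) * BB)       ∎)))
  where
  open ≤-Reasoning
  BB = B * B
  L = l * l
  c = 2 + j
  l≤fb′ : L * (suc b * c) ≤ (suc b + j) * BB
  l≤fb′ = subst (λ n → L * (suc b * c) ≤ n * BB) (num-edge b j) l≤fb
  cross : suc d * (suc b + j) ≤ suc b * (suc d + j)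
  cross = begin
    suc d * (suc b + j)          ≡⟨ *-distribˡ-+ (suc d) (suc b) j ⟩
    suc d * suc b + suc d * j    ≤⟨ +-mono-≤ (≤-reflexive (*-comm (suc d) (suc b))) (*-monoˡ-≤ j (s≤s d≤b)) ⟩
    suc b * suc d + suc b * j    ≡⟨ *-distribˡ-+ (suc b) (suc d) j ⟨
    suc b * (suc d + j)          ∎
  swap-degrees : ∀ L B D c → B * (L * (D * c)) ≡ D * (L * (B * c))
  swap-degrees = solve-∀

below-limit : ∀ {B l d j} → l * l * (2 + j) ≤ B * B → Below B (suc d , 2 + j) l
below-limit {B} {l} {d} {j} l²c≤B² =
  below (subst (λ n → l * l * (suc d * (2 + j)) ≤ n * (B * B)) (sym (num-edge d j)) (begin
    l * l * (suc d * (2 + j))    ≡⟨ reorder (l * l) (suc d) (2 + j) ⟩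
    suc d * (l * l * (2 + j))    ≤⟨ *-monoʳ-≤ (suc d) l²c≤B² ⟩
    suc d * (B * B)              ≤⟨ *-monoˡ-≤ (B * B) (m≤m+n (suc d) j) ⟩
    (suc d + j) * (B * B)        ∎))
  where
  open ≤-Reasoning
  reorder : ∀ L D c → L * (D * c) ≡ D * (L * c)
  reorder = solve-∀

sizes-++ : ∀ xs ys → sizes (xs ++ ys) ≡ sizes xs + sizes ys
sizes-++ [] ys = refl
sizes-++ (x ∷ xs) ys = trans (cong (λ s → size x + s) (sizes-++ xs ys)) (sym (+-assoc (size x) _ _))

edgesCh-++ : ∀ d xs ys → edgesCh d (xs ++ ys) ≡ edgesCh d xs ++ edgesCh d ys
edgesCh-++ d [] ys = refl
edgesCh-++ d (node us ∷ xs) ys = cong ((d , suc (length us)) ∷_) (begin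
  edgesCh (suc (length us)) us ++ edgesCh d (xs ++ ys)                 ≡⟨ cong (edgesCh (suc (length us)) us ++_) (edgesCh-++ d xs ys) ⟩
  edgesCh (suc (length us)) us ++ edgesCh d xs ++ edgesCh d ys          ≡⟨ ++-assoc (edgesCh (suc (length us)) us) _ _ ⟨
  (edgesCh (suc (length us)) us ++ edgesCh d xs) ++ edgesCh d ys        ∎)
  where open ≡-Reasoning

length-edgesCh : ∀ d cs → length (edgesCh d cs) ≡ sizes cs
length-edgesCh d [] = refl
length-edgesCh d (node us ∷ cs) = cong suc (begin
  length (edgesCh (suc (length us)) us ++ edgesCh d cs)                ≡⟨ length-++ (edgesCh (suc (length us)) us) ⟩
  length (edgesCh (suc (length us)) us) + length (edgesCh d cs)        ≡⟨ cong₂ _+_ (length-edgesCh (suc (length us)) us) (length-edgesCh d cs) ⟩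
  sizes us + sizes cs                                                  ∎)
  where open ≡-Reasoning

edgesCh-↭ : ∀ d {cs ds} → cs ↭ ds → edgesCh d cs ↭ edgesCh d ds
edgesCh-↭ d ↭-refl = ↭-refl
edgesCh-↭ d (prep (node us) cs↭ds) = ++⁺ˡ ((d , suc (length us)) ∷ edgesCh (suc (length us)) us) (edgesCh-↭ d cs↭ds)
edgesCh-↭ d (swap (node us) (node vs) cs↭ds) =
  ↭-trans (shifts (block us) (block vs)) (++⁺ˡ (block vs) (++⁺ˡ (block us) (edgesCh-↭ d cs↭ds)))
  where
  block : List Tree → List (ℕ × ℕ)
  block ws = (d , suc (length ws)) ∷ edgesCh (suc (length ws)) ws
edgesCh-↭ d (↭-trans cs↭bs bs↭ds) = ↭-trans (edgesCh-↭ d cs↭bs) (edgesCh-↭ d bs↭ds)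

sizes-↭ : ∀ {cs ds} → cs ↭ ds → sizes cs ≡ sizes ds
sizes-↭ {cs} {ds} cs↭ds =
  trans (sym (length-edgesCh 0 cs)) (trans (↭-length (edgesCh-↭ 0 cs↭ds)) (length-edgesCh 0 ds))

record Improves (D : ℕ) (cs′ cs : List Tree) : Set where
  constructor improves
  field
    same-length : length cs′ ≡ length cs
    same-size   : sizes cs′ ≡ sizes cs
    smaller     : edgesCh D cs′ ≺ edgesCh D cs

Improves-++ʳ : ∀ {D cs′ cs} rest → Improves D cs′ cs → Improves D (cs′ ++ rest) (cs ++ rest)
Improves-++ʳ {D} {cs′} {cs} rest (improves same-length same-size smaller) =
  improves
  (trans (length-++ cs′) (trans (cong (_+ length rest) same-length) (sym (length-++ cs))))
  (trans (sizes-++ cs′ rest) (trans (cong (_+ sizes rest) same-size) (sym (sizes-++ cs rest))))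
  (subst₂ _≺_ (sym (edgesCh-++ D cs′ rest)) (sym (edgesCh-++ D cs rest)) (≺-++ʳ (edgesCh D rest) smaller))

Improves-respʳ-↭ : ∀ {D cs′ cs ds} → Improves D cs′ cs → cs ↭ ds → Improves D cs′ ds
Improves-respʳ-↭ {D} (improves same-length same-size smaller) cs↭ds =
  improves (trans same-length (↭-length cs↭ds)) (trans same-size (sizes-↭ cs↭ds))
           (≺-respʳ-↭ smaller (edgesCh-↭ D cs↭ds))

Improves-child : ∀ {us′ us} d xs ys → Improves (suc (length us)) us′ us →
  Improves d (xs ++ node us′ ∷ ys) (xs ++ node us ∷ ys)
Improves-child {us′} {us} d xs ys (improves same-length same-size smaller) =
  improves
  (trans (length-++ xs) (sym (length-++ xs)))
  (trans (sizes-++ xs _) (trans (cong (λ s → sizes xs + (suc s + sizes ys)) same-size) (sym (sizes-++ xs _))))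
  (subst₂ _≺_ (sym (edgesCh-++ d xs (node us′ ∷ ys))) (sym (edgesCh-++ d xs (node us ∷ ys)))
    (≺-++ˡ (edgesCh d xs) at-child))
  where
  at-child : edgesCh d (node us′ ∷ ys) ≺ edgesCh d (node us ∷ ys)
  at-child rewrite same-length = ≺-++ˡ ((d , suc (length us)) ∷ []) (≺-++ʳ (edgesCh d ys) smaller)

Improves-below : ∀ {S T cs′} → S ⊏ T → Improves (degNR S) cs′ (children S) →
  ∃[ ts′ ] (∀ d → Improves d ts′ (children T))
Improves-below {node us} {node ts} {cs′} (child S∈ts) improvement with ∈-∃++ S∈ts
... | xs , ys , refl = xs ++ node cs′ ∷ ys , λ d → Improves-child d xs ys improvement
Improves-below {node us} {node ts} (deeper {C = node vs} C∈ts S⊏C) improvement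
  with Improves-below S⊏C improvement | ∈-∃++ C∈ts
... | vs′ , improvement′ | xs , ys , refl =
  xs ++ node vs′ ∷ ys , λ d → Improves-child d xs ys (improvement′ (suc (length vs)))

root-unimprovable : ∀ {T cs′} → MinimalABC T → ¬ Improves (length (children T)) cs′ (children T)
root-unimprovable {node cs} {cs′} (_ , minimal) (improves same-length same-size smaller) =
  minimal (node cs′) (cong suc same-size) (≺⇒SqrtSumLt (≤-reflexive same-edges) smaller′)
  where
  smaller′ : edges (node cs′) ≺ edges (node cs)
  smaller′ = subst (λ n → edgesCh n cs′ ≺ edgesCh (length cs) cs) (sym same-length) smaller
  same-edges : length (edges (node cs′)) ≡ length (edges (node cs))
  same-edges = trans (length-edgesCh (length cs′) cs′)
                 (trans same-size (sym (length-edgesCh (length cs) cs)))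

subtree-unimprovable : ∀ {S T cs′} → MinimalABC T → S ⊏ T → ¬ Improves (degNR S) cs′ (children S)
subtree-unimprovable {T = node ts} minimal S⊏T improvement with Improves-below S⊏T improvement
... | ts′ , improvement′ = root-unimprovable minimal (improvement′ (length ts))

-- B₁ is P3, so a B₁ child is exactly a pendant path of length three.
B₁ B₂ B₃ : Tree
B₁ = node (P2 ∷ [])
B₂ = node (P2 ∷ P2 ∷ [])
B₃ = node (P2 ∷ P2 ∷ P2 ∷ [])

IsB1⇒B₁ : ∀ {c} → IsB 1 c → c ≡ B₁
IsB1⇒B₁ {node []} (_ , () , _)
IsB1⇒B₁ {node (_ ∷ [])} (_ , _ , refl ∷ []) = refl
IsB1⇒B₁ {node (_ ∷ _ ∷ _)} (_ , () , _)

IsB2⇒B₂ : ∀ {c} → IsB 2 c → c ≡ B₂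
IsB2⇒B₂ {node []} (_ , () , _)
IsB2⇒B₂ {node (_ ∷ [])} (_ , () , _)
IsB2⇒B₂ {node (_ ∷ _ ∷ [])} (_ , _ , refl ∷ refl ∷ []) = refl
IsB2⇒B₂ {node (_ ∷ _ ∷ _ ∷ _)} (_ , () , _)

sort-B₁₂ : ∀ {cs} → All (λ c → IsB 1 c ⊎ IsB 2 c) cs → ∃₂ λ a b → cs ↭ replicate a B₁ ++ replicate b B₂
sort-B₁₂ [] = 0 , 0 , ↭-refl
sort-B₁₂ {c ∷ _} (inj₁ isB₁ ∷ rest) with sort-B₁₂ rest | IsB1⇒B₁ {c} isB₁
... | a , b , sorted | refl = suc a , b , prep B₁ sorted
sort-B₁₂ {c ∷ _} (inj₂ isB₂ ∷ rest) with sort-B₁₂ rest | IsB2⇒B₂ {c} isB₂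
... | a , b , sorted | refl =
  a , suc b , ↭-trans (prep B₂ sorted) (↭-sym (shift B₂ (replicate a B₁) (replicate b B₂)))

Any-replicate : ∀ {P : Tree → Set} n x → Any P (replicate n x) → P x
Any-replicate (suc n) x (here px) = px
Any-replicate (suc n) x (there pxs) = Any-replicate n x pxs

pendant⇒B₁ : ∀ a b → HasPendantPath (node (replicate a B₁ ++ replicate b B₂)) → 1 ≤ a
pendant⇒B₁ zero b pendant with Any-replicate b B₂ pendant
... | inj₁ ()
... | inj₂ ()
pendant⇒B₁ (suc a) b _ = s≤s z≤n

branching⇒B₂ : ∀ a b → Any (λ c → 3 ≤ degNR c) (replicate a B₁ ++ replicate b B₂) → 1 ≤ b
branching⇒B₂ a zero branching with ++⁻ (replicate a B₁) branching
... | inj₁ inB₁ with Any-replicate a B₁ inB₁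
...   | s≤s (s≤s ())
branching⇒B₂ a zero branching | inj₂ ()
branching⇒B₂ a (suc b) _ = s≤s z≤n

-- √½⁻ / 10⁶ < 1/√2 < √½⁺ / 10⁶
10⁶ √½⁺ √½⁻ : ℕ
10⁶ = 1000000
√½⁺ = 707107
√½⁻ = 707106

⌈P2⌉ ⌊B₁⌋ : List ℕ
⌈P2⌉ = √½⁺ ∷ √½⁺ ∷ []
⌊B₁⌋ = √½⁻ ∷ √½⁻ ∷ √½⁻ ∷ []

⌈B₂⌉ ⌊B₂⌋ ⌈B₃⌉ : ℕ → List ℕ
⌈B₂⌉ h = h ∷ √½⁺ ∷ √½⁺ ∷ √½⁺ ∷ √½⁺ ∷ []
⌊B₂⌋ l = l ∷ √½⁻ ∷ √½⁻ ∷ √½⁻ ∷ √½⁻ ∷ []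
⌈B₃⌉ h = h ∷ √½⁺ ∷ √½⁺ ∷ √½⁺ ∷ √½⁺ ∷ √½⁺ ∷ √½⁺ ∷ []

above-P2 : ∀ {d} → Pointwise (Above 10⁶) (edgesCh (suc d) (P2 ∷ [])) ⌈P2⌉
above-P2 = above-½ decide ∷ above decide ∷ []

below-B₁ : ∀ {d} → Pointwise (Below 10⁶) (edgesCh (suc d) (B₁ ∷ [])) ⌊B₁⌋
below-B₁ = below-limit decide ∷ below decide ∷ below decide ∷ []

above-B₂ : ∀ {d h} → Above 10⁶ (suc d , 3) h → Pointwise (Above 10⁶) (edgesCh (suc d) (B₂ ∷ [])) (⌈B₂⌉ h)
above-B₂ top = top ∷ above decide ∷ above decide ∷ above decide ∷ above decide ∷ []

below-B₂ : ∀ {d l} → Below 10⁶ (suc d , 3) l → Pointwise (Below 10⁶) (edgesCh (suc d) (B₂ ∷ [])) (⌊B₂⌋ l)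
below-B₂ top = top ∷ below decide ∷ below decide ∷ below decide ∷ below decide ∷ []

above-B₃ : ∀ {d h} → Above 10⁶ (suc d , 4) h → Pointwise (Above 10⁶) (edgesCh (suc d) (B₃ ∷ [])) (⌈B₃⌉ h)
above-B₃ top = top ∷ above decide ∷ above decide ∷ above decide ∷ above decide ∷ above decide ∷ above decide ∷ []

improves-B₁B₁B₁ : ∀ {d} → 6 ≤ d → Improves (suc d) (P2 ∷ P2 ∷ B₂ ∷ []) (B₁ ∷ B₁ ∷ B₁ ∷ [])
improves-B₁B₁B₁ 6≤d = improves refl refl (certified-≺
  (above-P2 ++ᵖ above-P2 ++ᵖ above-B₂ {h = 617214} (above-mono 6≤d (above decide)))
  (below-B₁ ++ᵖ below-B₁ ++ᵖ below-B₁)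
  decide)

improves-B₁B₁B₂ : ∀ {d} → 6 ≤ d → Improves (suc d) (P2 ∷ P2 ∷ B₃ ∷ []) (B₁ ∷ B₁ ∷ B₂ ∷ [])
improves-B₁B₁B₂ 6≤d = improves refl refl (certified-≺
  (above-P2 ++ᵖ above-P2 ++ᵖ above-B₃ {h = 566947} (above-mono 6≤d (above decide)))
  (below-B₁ ++ᵖ below-B₁ ++ᵖ below-B₂ {l = 577350} (below-limit decide))
  decide)

improves-B₁B₂B₂B₂-by : ∀ {d} h l → Above 10⁶ (suc d , 4) h → Below 10⁶ (suc d , 3) l →
  sum (⌈P2⌉ ++ ⌈P2⌉ ++ ⌈B₃⌉ h ++ ⌈B₃⌉ h) < sum (⌊B₁⌋ ++ ⌊B₂⌋ l ++ ⌊B₂⌋ l ++ ⌊B₂⌋ l) →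
  Improves (suc d) (P2 ∷ P2 ∷ B₃ ∷ B₃ ∷ []) (B₁ ∷ B₂ ∷ B₂ ∷ B₂ ∷ [])
improves-B₁B₂B₂B₂-by h l top⁺ top⁻ margin = improves refl refl (certified-≺
  (above-P2 ++ᵖ above-P2 ++ᵖ above-B₃ top⁺ ++ᵖ above-B₃ top⁺)
  (below-B₁ ++ᵖ below-B₂ top⁻ ++ᵖ below-B₂ top⁻ ++ᵖ below-B₂ top⁻)
  margin)

-- This move needs 1/√2 + 2 f(D , 4) < 3 f(D , 3), with a slack of only 0.01 to
-- 0.025, less than the variation of f(D , 4) and f(D , 3) over D ≥ 7; so the
-- bounds are taken per window of degrees, by monotonicity of f in D.
improves-B₁B₂B₂B₂ : ∀ {d} → 6 ≤ d → Improves (suc d) (P2 ∷ P2 ∷ B₃ ∷ B₃ ∷ []) (B₁ ∷ B₂ ∷ B₂ ∷ B₂ ∷ [])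
improves-B₁B₂B₂B₂ {d} 6≤d with d ≤? 6 | d ≤? 8 | d ≤? 11 | d ≤? 16 | d ≤? 28 | d ≤? 38
... | yes d≤6 | _ | _ | _ | _ | _ =
  improves-B₁B₂B₂B₂-by 566947 617213 (above-mono 6≤d (above decide)) (below-anti d≤6 (below decide)) decide
... | no d≰6 | yes d≤8 | _ | _ | _ | _ =
  improves-B₁B₂B₂B₂-by 559017 608580 (above-mono (≰⇒> d≰6) (above decide)) (below-anti d≤8 (below decide)) decide
... | no _ | no d≰8 | yes d≤11 | _ | _ | _ =
  improves-B₁B₂B₂B₂-by 547723 600925 (above-mono (≰⇒> d≰8) (above decide)) (below-anti d≤11 (below decide)) decide
... | no _ | no _ | no d≰11 | yes d≤16 | _ | _ =
  improves-B₁B₂B₂B₂-by 537087 594088 (above-mono (≰⇒> d≰11) (above decide)) (below-anti d≤16 (below decide)) decide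
... | no _ | no _ | no _ | no d≰16 | yes d≤28 | _ =
  improves-B₁B₂B₂B₂-by 527047 587220 (above-mono (≰⇒> d≰16) (above decide)) (below-anti d≤28 (below decide)) decide
... | no _ | no _ | no _ | no _ | no d≰28 | yes d≤38 =
  improves-B₁B₂B₂B₂-by 516398 584705 (above-mono (≰⇒> d≰28) (above decide)) (below-anti d≤38 (below decide)) decide
... | no _ | no _ | no _ | no _ | no _ | no d≰38 =
  improves-B₁B₂B₂B₂-by 512348 577350 (above-mono (≰⇒> d≰38) (above decide)) (below-limit decide) decide

improves-sorted : ∀ {d} a b → 6 ≤ d → 1 ≤ a → 1 ≤ b → 4 ≤ a + b →
  ∃[ cs′ ] Improves (suc d) cs′ (replicate a B₁ ++ replicate b B₂)
improves-sorted (suc (suc (suc a))) b 6≤d _ _ _ =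
  _ , Improves-++ʳ (replicate a B₁ ++ replicate b B₂) (improves-B₁B₁B₁ 6≤d)
improves-sorted 2 (suc b) 6≤d _ _ _ = _ , Improves-++ʳ (replicate b B₂) (improves-B₁B₁B₂ 6≤d)
improves-sorted 1 (suc (suc (suc b))) 6≤d _ _ _ = _ , Improves-++ʳ (replicate b B₂) (improves-B₁B₂B₂B₂ 6≤d)
improves-sorted 0 _ _ () _ _
improves-sorted 2 0 _ _ () _
improves-sorted 1 0 _ _ () _
improves-sorted 1 1 _ _ _ (s≤s (s≤s ()))
improves-sorted 1 2 _ _ _ (s≤s (s≤s (s≤s ())))

improves-B₁₂ : ∀ {D} t → 7 ≤ D → AllChildrenB12 t → HasPendantPath t →
  Any (λ c → 3 ≤ degNR c) (children t) → 4 ≤ length (children t) → ∃[ cs′ ] Improves D cs′ (children t)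
improves-B₁₂ {suc d} (node cs) (s≤s 6≤d) allB₁₂ pendant branching 4≤n =
  let a , b , sorted = sort-B₁₂ allB₁₂
      count : length cs ≡ a + b
      count = trans (↭-length sorted)
                (trans (length-++ (replicate a B₁)) (cong₂ _+_ (length-replicate a) (length-replicate b)))
      cs′ , improvement = improves-sorted a b 6≤d
        (pendant⇒B₁ a b (Any-resp-↭ sorted pendant))
        (branching⇒B₂ a b (Any-resp-↭ sorted branching))
        (subst (4 ≤_) count 4≤n)
  in cs′ , Improves-respʳ-↭ improvement (↭-sym sorted)

lemma3p3 : (T : Tree) → MinimalABC T →
    ((k : _) → 8 ≤ k → (S : Tree) → S ⊏ T → ProperTBranch k S → ¬ AllChildrenB12 S)
    × ((k : _) → 7 ≤ k → ProperTTree k T → ¬ AllChildrenB12 T)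
lemma3p3 T minimal = no-branch , no-root
  where
  no-branch : (k : ℕ) → 8 ≤ k → (S : Tree) → S ⊏ T → ProperTBranch k S → ¬ AllChildrenB12 S
  no-branch k 8≤k S S⊏T (k-children , _ , pendant , branching) allB₁₂ =
    subtree-unimprovable minimal S⊏T (proj₂ (improves-B₁₂ S 7≤D allB₁₂ pendant branching 4≤k))
    where
    6≤k : 6 ≤ length (children S)
    6≤k = subst (6 ≤_) (sym k-children) (≤-trans decide 8≤k)
    7≤D : 7 ≤ degNR S
    7≤D = s≤s 6≤k
    4≤k : 4 ≤ length (children S)
    4≤k = ≤-trans decide 6≤k
  no-root : (k : ℕ) → 7 ≤ k → ProperTTree k T → ¬ AllChildrenB12 T
  no-root k 7≤k (k-children , _ , pendant , branching) allB₁₂ =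
    root-unimprovable minimal (proj₂ (improves-B₁₂ T 7≤D allB₁₂ pendant branching (≤-trans decide 7≤D)))
    where
    7≤D : 7 ≤ length (children T)
    7≤D = subst (7 ≤_) (sym k-children) 7≤k
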